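{- Let $G$ be a finite $2$-transitive permutation group with a regular normal subgroup $N$ and point stabilizer $G_x$, so $G=NG_x$. A complement $K$ to $N$ in $G$ is a coclique in the derangement graph $\Gamma_G$ if and only if every element of $K$ is $G$-conjugate to an element of $G_x$.
   Context: $\Gamma_G$ has vertex set $G$, with $g,h$ adjacent iff $hg^{ -1}$ has no fixed point. A coclique is an independent set. A complement to $N$ is a subgroup $K$ with $NK=G$ and $N\cap K=1$. -}

module Defs where

open import Level using (Level; suc; _⊔_)
open import Data.Nat using (ℕ; _≤_)
open import Data.Fin using (Fin)
open import Data.Product using (Σ; ∃; ∃-syntax; _×_; _,_)
open import Relation.Nullary using (¬_)
open import Relation.Binary.PropositionalEquality using (_≡_)
open import Data.Fin.Permutation as P using (Permutation′; _⟨$⟩ʳ_; _⟨$⟩ˡ_)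

Perm : ℕ → Set
Perm n = Permutation′ n

_≈_ : ∀ {n} → Perm n → Perm n → Set
_≈_ = P._≈_

-- Group operations on Sym(Fin n), with the usual right-to-left
-- convention: (g · h) a = g (h a).
_·_ : ∀ {n} → Perm n → Perm n → Perm n
g · h = h P.∘ₚ g

_⁻¹ : ∀ {n} → Perm n → Perm n
g ⁻¹ = P.flip g

e : ∀ {n} → Perm n
e = P.id

Subset : ℕ → Set₁
Subset n = Perm n → Set

-- Subgroup of Sym(Fin n) (closed under ≈ so that it is a genuine set of
-- permutations).
record IsSubgroup {n : ℕ} (H : Subset n) : Set where
  field
    resp-≈ : ∀ {g h} → g ≈ h → H g → H h
    has-e  : H e
    ·-closed : ∀ {g h} → H g → H h → H (g · h)
    ⁻¹-closed : ∀ {g} → H g → H (g ⁻¹)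

_⊆_ : ∀ {n} → Subset n → Subset n → Set
K ⊆ H = ∀ {g} → K g → H g

IsTwoTransitive : ∀ {n} → Subset n → Set
IsTwoTransitive {n} G =
  (2 ≤ n) ×
  (∀ (a b c d : Fin n) → ¬ a ≡ b → ¬ c ≡ d →
     ∃[ g ] (G g × (g ⟨$⟩ʳ a ≡ c) × (g ⟨$⟩ʳ b ≡ d)))

IsRegular : ∀ {n} → Subset n → Set
IsRegular {n} N =
  ∀ (a b : Fin n) →
    (∃[ g ] (N g × g ⟨$⟩ʳ a ≡ b)) ×
    (∀ g h → N g → N h → g ⟨$⟩ʳ a ≡ b → h ⟨$⟩ʳ a ≡ b → g ≈ h)

IsNormalIn : ∀ {n} → Subset n → Subset n → Set
IsNormalIn N G = ∀ {g h} → G g → N h → N ((g · h) · (g ⁻¹))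

Stab : ∀ {n} → Subset n → Fin n → Subset n
Stab G x g = G g × (g ⟨$⟩ʳ x ≡ x)

IsComplement : ∀ {n} → Subset n → Subset n → Subset n → Set
IsComplement G N K =
  IsSubgroup K × (K ⊆ G) ×
  (∀ {g} → G g → ∃[ m ] ∃[ k ] (N m × K k × g ≈ (m · k))) ×
  (∀ {g} → N g → K g → g ≈ e)

-- Derangement graph Γ_G: g,h adjacent iff h g⁻¹ has no fixed point.
-- (Adjacency is only considered between vertices of G.)
Adjacent : ∀ {n} → Perm n → Perm n → Set
Adjacent {n} g h = ¬ (∃[ a ] ((h · (g ⁻¹)) ⟨$⟩ʳ a ≡ a))

IsCoclique : ∀ {n} → Subset n → Subset n → Set
IsCoclique G K = (K ⊆ G) × (∀ g h → K g → K h → ¬ g ≈ h → ¬ Adjacent g h)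

ConjugateInto : ∀ {n} → Subset n → Subset n → Perm n → Set
ConjugateInto G S k = ∃[ g ] ∃[ s ] (G g × S s × ((g · k) · (g ⁻¹)) ≈ s)

-- The theorem reduces to two independent facts, each true in greater
-- generality than stated.
--
--  * Conjugacy (for any transitive group G): an element k of G is
--    G-conjugate into the point stabiliser G_x iff k has a fixed point.
--    Conjugating by c turns a fixed point a of k into the fixed point
--    c a of c k c⁻¹, and transitivity lets us choose c with c a = x.
--
--  * Cocliques (for any subgroup K of Sym(Fin n)): K is a coclique of
--    the derangement graph iff every element of K has a fixed point.
--    For g, h ∈ K, the element h g⁻¹ lies in K, so non-adjacency of g
--    and h is exactly "h g⁻¹ has a fixed point"; conversely k is not
--    adjacent to the identity, and having a fixed point is decidable.
--    (This direction needs at least one point.)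
--
-- The group G of the theorem is transitive because its regular
-- subgroup N already is, so the two facts combine to the statement.
module Submission where

open import Defs
open import Data.Nat using (ℕ)
open import Data.Fin using (Fin)
open import Data.Fin.Properties using (any?; _≟_)
open import Data.Product using (_×_; _,_; proj₁; ∃)
open import Data.Empty using (⊥-elim)
open import Relation.Nullary using (¬_; Dec; yes; no)
open import Relation.Binary.PropositionalEquality
  using (_≡_; refl; sym; trans; cong; module ≡-Reasoning)
open import Data.Fin.Permutation as P using (_⟨$⟩ʳ_; _⟨$⟩ˡ_)

HasFixedPoint : ∀ {n} → Perm n → Set
HasFixedPoint {n} k = ∃ λ (a : Fin n) → k ⟨$⟩ʳ a ≡ a

IsTransitive : ∀ {n} → Subset n → Set
IsTransitive {n} G = ∀ (a b : Fin n) → ∃ λ g → G g × g ⟨$⟩ʳ a ≡ b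

regular⇒transitive : ∀ {n} {N : Subset n} → IsRegular N → IsTransitive N
regular⇒transitive reg a b = proj₁ (reg a b)

transitive-⊆ : ∀ {n} {N G : Subset n} → N ⊆ G → IsTransitive N → IsTransitive G
transitive-⊆ N⊆G trN a b with trN a b
... | g , Ng , ga = g , N⊆G Ng , ga

hasFixedPoint? : ∀ {n} (k : Perm n) → Dec (HasFixedPoint k)
hasFixedPoint? k = any? (λ a → k ⟨$⟩ʳ a ≟ a)

conj-fixes : ∀ {n} (c k : Perm n) (a : Fin n) → k ⟨$⟩ʳ a ≡ a →
             ((c · k) · (c ⁻¹)) ⟨$⟩ʳ (c ⟨$⟩ʳ a) ≡ c ⟨$⟩ʳ a
conj-fixes c k a ka = begin
  c ⟨$⟩ʳ (k ⟨$⟩ʳ (c ⟨$⟩ˡ (c ⟨$⟩ʳ a)))  ≡⟨ cong (λ b → c ⟨$⟩ʳ (k ⟨$⟩ʳ b)) (P.inverseˡ c) ⟩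
  c ⟨$⟩ʳ (k ⟨$⟩ʳ a)                    ≡⟨ cong (c ⟨$⟩ʳ_) ka ⟩
  c ⟨$⟩ʳ a                             ∎
  where open ≡-Reasoning

unconj-fixes : ∀ {n} (c k : Perm n) (x : Fin n) →
               ((c · k) · (c ⁻¹)) ⟨$⟩ʳ x ≡ x → k ⟨$⟩ʳ (c ⟨$⟩ˡ x) ≡ c ⟨$⟩ˡ x
unconj-fixes c k x fix = begin
  k ⟨$⟩ʳ (c ⟨$⟩ˡ x)                           ≡⟨ sym (P.inverseˡ c) ⟩
  c ⟨$⟩ˡ (c ⟨$⟩ʳ (k ⟨$⟩ʳ (c ⟨$⟩ˡ x)))          ≡⟨ cong (c ⟨$⟩ˡ_) fix ⟩
  c ⟨$⟩ˡ x                                    ∎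
  where open ≡-Reasoning

conjugateIntoStab⇒fixedPoint : ∀ {n} (G : Subset n) (x : Fin n) (k : Perm n) →
                               ConjugateInto G (Stab G x) k → HasFixedPoint k
conjugateIntoStab⇒fixedPoint G x k (c , s , _ , (_ , sx≡x) , ckc⁻¹≈s) =
  c ⟨$⟩ˡ x , unconj-fixes c k x (trans (ckc⁻¹≈s x) sx≡x)

module _ {n} {G : Subset n} (sG : IsSubgroup G) (trG : IsTransitive G) (x : Fin n) where
  open IsSubgroup sG using (·-closed; ⁻¹-closed)

  fixedPoint⇒conjugateIntoStab : ∀ {k} → G k → HasFixedPoint k →
                                 ConjugateInto G (Stab G x) k
  fixedPoint⇒conjugateIntoStab {k} Gk (a , ka) with trG a x
  ... | c , Gc , ca≡x = c , (c · k) · (c ⁻¹) , Gc , (Gckc⁻¹ , fixes-x) , λ _ → refl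
    where
    Gckc⁻¹ : G ((c · k) · (c ⁻¹))
    Gckc⁻¹ = ·-closed (·-closed Gc Gk) (⁻¹-closed Gc)

    fixes-x : ((c · k) · (c ⁻¹)) ⟨$⟩ʳ x ≡ x
    fixes-x rewrite sym ca≡x = conj-fixes c k a ka

module _ {n} {G K : Subset n} (sK : IsSubgroup K) (K⊆G : K ⊆ G) where
  open IsSubgroup sK using (has-e; ·-closed; ⁻¹-closed)

  -- Each k ∈ K is non-adjacent to e ∈ K, so ¬¬ HasFixedPoint k, and
  -- decidability removes the double negation.  A point a is needed to
  -- tell k from e when k ≈ e; over the empty set the claim fails.
  coclique⇒fixedPoints : Fin n → IsCoclique G K → ∀ k → K k → HasFixedPoint k
  coclique⇒fixedPoints a (_ , nonAdj) k Kk with hasFixedPoint? k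
  ... | yes fix   = fix
  ... | no nofix  = ⊥-elim (nonAdj e k has-e Kk e≉k nofix)
    where
    e≉k : ¬ e ≈ k
    e≉k e≈k = nofix (a , sym (e≈k a))

  -- g, h ∈ K are non-adjacent because h g⁻¹ ∈ K has a fixed point.
  fixedPoints⇒coclique : (∀ k → K k → HasFixedPoint k) → IsCoclique G K
  fixedPoints⇒coclique fix = K⊆G , λ g h Kg Kh _ adj →
    adj (fix (h · (g ⁻¹)) (·-closed Kh (⁻¹-closed Kg)))

-- Lemma 6.1: a complement K to the regular normal subgroup N of G is a
-- coclique of Γ_G iff each element of K is G-conjugate into G_x.
lemma6p1 : ∀ {n : ℕ} (G N K : Subset n) (x : Fin n) →
    IsSubgroup G → IsTwoTransitive G →
    IsSubgroup N → N ⊆ G → IsRegular N → IsNormalIn N G →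
    IsComplement G N K →
    (IsCoclique G K → ∀ k → K k → ConjugateInto G (Stab G x) k) ×
    ((∀ k → K k → ConjugateInto G (Stab G x) k) → IsCoclique G K)
lemma6p1 G N K x sG _ _ N⊆G reg _ (sK , K⊆G , _ , _) =
  (λ cc k Kk → toStab (K⊆G Kk) (coclique⇒fixedPoints sK K⊆G x cc k Kk)) ,
  (λ conj → fixedPoints⇒coclique sK K⊆G (λ k Kk → fromStab k (conj k Kk)))
  where
  trG : IsTransitive G
  trG = transitive-⊆ N⊆G (regular⇒transitive reg)

  toStab : ∀ {k} → G k → HasFixedPoint k → ConjugateInto G (Stab G x) k
  toStab = fixedPoint⇒conjugateIntoStab sG trG x

  fromStab : ∀ k → ConjugateInto G (Stab G x) k → HasFixedPoint k
  fromStab = conjugateIntoStab⇒fixedPoint G x
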